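{- Let $f:\mathbb{F}_2^n\to\{ -1,1\}$ be a Boolean function with Fourier support $\mathcal{S}$, where $|\mathcal{S}|\ge2$, and let $\alpha,\beta$ be two distinct elements of $\mathcal{S}$. Then there exists a Boolean function $g:\mathbb{F}_2^n\to\{ -1,1\}$ with Fourier support $\mathcal{S}$ such that $\widehat g(\alpha)>0$ and $\widehat g(\beta)>0$.
   Context: For $\alpha\in\mathbb{F}_2^n$ let $\chi_\alpha(x)=(-1)^{\sum_i\alpha_ix_i}$; every $f:\mathbb{F}_2^n\to\mathbb{R}$ is uniquely $f=\sum_\alpha\widehat f(\alpha)\chi_\alpha$ with $\widehat f(\alpha)=2^{ -n}\sum_xf(x)\chi_\alpha(x)$; the Fourier support is $\{\alpha:\widehat f(\alpha)\ne0\}$. -}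

module Defs where

open import Data.Bool using (Bool; true; false; _xor_; _∧_)
open import Data.Vec using (Vec; []; _∷_)
open import Data.Nat as ℕ using (ℕ; zero; suc)
open import Data.Integer as ℤ using (ℤ; +_; -_)
open import Data.List using (List; []; _∷_; map; _++_; foldr)
open import Data.Rational as ℚ using (ℚ)
open import Data.Sum using (_⊎_)
open import Data.Nat.Properties using (m^n≢0)
open import Relation.Binary.PropositionalEquality using (_≢_)
open import Relation.Binary.PropositionalEquality using (_≡_)

F2^ : ℕ → Set
F2^ n = Vec Bool n

points : (n : ℕ) → List (F2^ n)
points zero = [] ∷ []
points (suc n) = map (false ∷_) (points n) ++ map (true ∷_) (points n)

dot : (n : ℕ) → F2^ n → F2^ n → Bool
dot zero [] [] = false
dot (suc n) (a ∷ α) (b ∷ x) = (a ∧ b) xor dot n α x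

χ : {n : ℕ} → F2^ n → F2^ n → ℤ
χ {n} α x with dot n α x
... | false = + 1
... | true  = - (+ 1)

sumℤ : List ℤ → ℤ
sumℤ = foldr ℤ._+_ (+ 0)

fourier : {n : ℕ} → (F2^ n → ℤ) → F2^ n → ℚ
fourier {n} f α = (sumℤ (map (λ x → f x ℤ.* χ α x) (points n)) ℚ./ (2 ℕ.^ n)) {{m^n≢0 2 n}}

IsBoolean : {n : ℕ} → (F2^ n → ℤ) → Set
IsBoolean f = ∀ x → (f x ≡ + 1) ⊎ (f x ≡ - (+ 1))

InSupport : {n : ℕ} → (F2^ n → ℤ) → F2^ n → Set
InSupport f α = fourier f α ≢ ℚ.0ℚ

{-# OPTIONS --safe #-}
-- Translating f by a and multiplying it by a sign s keeps it Boolean and multiplies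
-- f̂(γ) by s·χ_γ(a), so the Fourier support is unchanged.  The characters separate
-- points, so a can be chosen with χ_α(a)χ_β(a) equal to the product of the signs of
-- f̂(α) and f̂(β); a suitable s then makes both coefficients positive.
module Submission where

open import Defs
open import Data.Nat using (ℕ)
open import Data.Integer using (ℤ)
open import Data.Product using (Σ; _×_)
open import Function.Bundles using (_⇔_)
open import Data.Rational using (_<_; 0ℚ)
open import Relation.Binary.PropositionalEquality using (_≢_)

open import Algebra using (CommutativeRing)
open import Data.Bool using (Bool; true; false; _xor_; _∧_; not)
open import Data.Bool.Properties
  using (∧-zeroʳ; ∧-distribˡ-xor; xor-assoc; xor-same; xor-identityʳ; xor-∧-commutativeRing)
open import Data.Integer as ℤ using (+_; -_; +[1+_]; -[1+_]; 0ℤ; +<+)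
import Data.Integer.Properties as ℤ
import Data.Integer.GCD as ℤ
open import Data.Integer.Tactic.RingSolver using (solve-∀)
open import Data.List using ([]; _∷_; map; _++_)
open import Data.List.Properties using (map-++; map-∘; map-cong)
open import Data.Nat as ℕ using (zero; suc; s≤s; z≤n)
open import Data.Nat.Properties using (m^n≢0)
open import Data.Product using (_,_; proj₁; proj₂)
open import Data.Rational as ℚ using ()
import Data.Rational.Properties as ℚ
open import Data.Sum using (_⊎_; inj₁; inj₂)
open import Data.Vec using ([]; _∷_)
open import Function.Bundles using (mk⇔; Equivalence)
open import Relation.Nullary.Negation using (contradiction; contraposition)
open import Relation.Binary.PropositionalEquality
  using (_≡_; refl; sym; trans; cong; cong₂; subst; module ≡-Reasoning)

open import Algebra.Properties.CommutativeSemigroup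
  (CommutativeRing.+-commutativeSemigroup xor-∧-commutativeRing) using (interchange)

open ≡-Reasoning

xor-cancelʳ : ∀ x a → (x xor a) xor a ≡ x
xor-cancelʳ x a = begin
  (x xor a) xor a ≡⟨ xor-assoc x a a ⟩
  x xor (a xor a) ≡⟨ cong (x xor_) (xor-same a) ⟩
  x xor false     ≡⟨ xor-identityʳ x ⟩
  x               ∎

xor-cancelˡ : ∀ x a → x xor (x xor a) ≡ a
xor-cancelˡ x a = begin
  x xor (x xor a) ≡⟨ xor-assoc x x a ⟨
  (x xor x) xor a ≡⟨ cong (_xor a) (xor-same x) ⟩
  a               ∎

infixl 6 _⊕_

_⊕_ : ∀ {n} → F2^ n → F2^ n → F2^ n
[]       ⊕ []       = []
(x ∷ xs) ⊕ (y ∷ ys) = (x xor y) ∷ (xs ⊕ ys)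

⊕-cancelʳ : ∀ {n} (x a : F2^ n) → (x ⊕ a) ⊕ a ≡ x
⊕-cancelʳ []       []       = refl
⊕-cancelʳ (x ∷ xs) (a ∷ as) = cong₂ _∷_ (xor-cancelʳ x a) (⊕-cancelʳ xs as)

zeros : ∀ n → F2^ n
zeros zero    = []
zeros (suc n) = false ∷ zeros n

dot-⊕ʳ : ∀ n (γ x a : F2^ n) → dot n γ (x ⊕ a) ≡ dot n γ x xor dot n γ a
dot-⊕ʳ zero    []      []       []       = refl
dot-⊕ʳ (suc n) (g ∷ γ) (x ∷ xs) (a ∷ as) = begin
  (g ∧ (x xor a)) xor dot n γ (xs ⊕ as)
    ≡⟨ cong₂ _xor_ (∧-distribˡ-xor g x a) (dot-⊕ʳ n γ xs as) ⟩
  ((g ∧ x) xor (g ∧ a)) xor (dot n γ xs xor dot n γ as)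
    ≡⟨ interchange (g ∧ x) (g ∧ a) (dot n γ xs) (dot n γ as) ⟩
  ((g ∧ x) xor dot n γ xs) xor ((g ∧ a) xor dot n γ as)
    ∎

dot-zerosʳ : ∀ n (γ : F2^ n) → dot n γ (zeros n) ≡ false
dot-zerosʳ zero    []      = refl
dot-zerosʳ (suc n) (g ∷ γ) = cong₂ _xor_ (∧-zeroʳ g) (dot-zerosʳ n γ)

dot-separates : ∀ n {α β : F2^ n} → α ≢ β → Σ (F2^ n) λ a → dot n α a xor dot n β a ≡ true
dot-separates zero    {[]}    {[]}    α≢β = contradiction refl α≢β
dot-separates (suc n) {false ∷ α} {false ∷ β} α≢β =
  let a , sep = dot-separates n (λ α≡β → α≢β (cong (false ∷_) α≡β)) in false ∷ a , sep
dot-separates (suc n) {true ∷ α} {true ∷ β} α≢β =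
  let a , sep = dot-separates n (λ α≡β → α≢β (cong (true ∷_) α≡β)) in false ∷ a , sep
dot-separates (suc n) {false ∷ α} {true ∷ β} _ =
  true ∷ zeros n , cong₂ _xor_ (dot-zerosʳ n α) (cong not (dot-zerosʳ n β))
dot-separates (suc n) {true ∷ α} {false ∷ β} _ =
  true ∷ zeros n , cong₂ _xor_ (cong not (dot-zerosʳ n α)) (dot-zerosʳ n β)

dot-xor-surjective : ∀ n {α β : F2^ n} → α ≢ β →
  ∀ b → Σ (F2^ n) λ a → dot n α a xor dot n β a ≡ b
dot-xor-surjective n {α} {β} _ false = zeros n , cong₂ _xor_ (dot-zerosʳ n α) (dot-zerosʳ n β)
dot-xor-surjective n         α≢β true  = dot-separates n α≢β

sgn : Bool → ℤ
sgn false = + 1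
sgn true  = - (+ 1)

sgn-xor : ∀ a b → sgn (a xor b) ≡ sgn a ℤ.* sgn b
sgn-xor false false = refl
sgn-xor false true  = refl
sgn-xor true  false = refl
sgn-xor true  true  = refl

χ≡sgn∘dot : ∀ {n} (γ x : F2^ n) → χ γ x ≡ sgn (dot n γ x)
χ≡sgn∘dot {n} γ x with dot n γ x
... | false = refl
... | true  = refl

χ-⊕ʳ : ∀ {n} (γ x a : F2^ n) → χ γ (x ⊕ a) ≡ χ γ x ℤ.* χ γ a
χ-⊕ʳ {n} γ x a = begin
  χ γ (x ⊕ a)                          ≡⟨ χ≡sgn∘dot γ (x ⊕ a) ⟩
  sgn (dot n γ (x ⊕ a))                ≡⟨ cong sgn (dot-⊕ʳ n γ x a) ⟩
  sgn (dot n γ x xor dot n γ a)        ≡⟨ sgn-xor (dot n γ x) (dot n γ a) ⟩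
  sgn (dot n γ x) ℤ.* sgn (dot n γ a)  ≡⟨ cong₂ ℤ._*_ (χ≡sgn∘dot γ x) (χ≡sgn∘dot γ a) ⟨
  χ γ x ℤ.* χ γ a                      ∎

sumℤ-++ : ∀ xs ys → sumℤ (xs ++ ys) ≡ sumℤ xs ℤ.+ sumℤ ys
sumℤ-++ []       ys = sym (ℤ.+-identityˡ (sumℤ ys))
sumℤ-++ (x ∷ xs) ys = trans (cong (λ t → x ℤ.+ t) (sumℤ-++ xs ys)) (sym (ℤ.+-assoc x (sumℤ xs) (sumℤ ys)))

sumℤ-map-*ˡ : ∀ {A : Set} c (h : A → ℤ) xs →
  sumℤ (map (λ x → c ℤ.* h x) xs) ≡ c ℤ.* sumℤ (map h xs)
sumℤ-map-*ˡ c h []       = sym (ℤ.*-zeroʳ c)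
sumℤ-map-*ˡ c h (x ∷ xs) =
  trans (cong (λ t → c ℤ.* h x ℤ.+ t) (sumℤ-map-*ˡ c h xs)) (sym (ℤ.*-distribˡ-+ c (h x) _))

sumAll : ∀ n → (F2^ n → ℤ) → ℤ
sumAll n h = sumℤ (map h (points n))

sumAll-cong : ∀ n {h k : F2^ n → ℤ} → (∀ x → h x ≡ k x) → sumAll n h ≡ sumAll n k
sumAll-cong n h≗k = cong sumℤ (map-cong h≗k (points n))

sumAll-*ˡ : ∀ n c (h : F2^ n → ℤ) → sumAll n (λ x → c ℤ.* h x) ≡ c ℤ.* sumAll n h
sumAll-*ˡ n c h = sumℤ-map-*ˡ c h (points n)

sumAll-suc : ∀ n (h : F2^ (suc n) → ℤ) →
  sumAll (suc n) h ≡ sumAll n (λ x → h (false ∷ x)) ℤ.+ sumAll n (λ x → h (true ∷ x))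
sumAll-suc n h = begin
  sumℤ (map h (map (false ∷_) (points n) ++ map (true ∷_) (points n)))
    ≡⟨ cong sumℤ (map-++ h (map (false ∷_) (points n)) (map (true ∷_) (points n))) ⟩
  sumℤ (map h (map (false ∷_) (points n)) ++ map h (map (true ∷_) (points n)))
    ≡⟨ sumℤ-++ (map h (map (false ∷_) (points n))) (map h (map (true ∷_) (points n))) ⟩
  sumℤ (map h (map (false ∷_) (points n))) ℤ.+ sumℤ (map h (map (true ∷_) (points n)))
    ≡⟨ cong₂ ℤ._+_ (cong sumℤ (map-∘ (points n))) (cong sumℤ (map-∘ (points n))) ⟨
  sumAll n (λ x → h (false ∷ x)) ℤ.+ sumAll n (λ x → h (true ∷ x))
    ∎

sumAll-translate : ∀ n (a : F2^ n) (h : F2^ n → ℤ) → sumAll n (λ x → h (x ⊕ a)) ≡ sumAll n h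
sumAll-translate zero    []        h = refl
sumAll-translate (suc n) (false ∷ a) h = begin
  sumAll (suc n) (λ x → h (x ⊕ (false ∷ a)))
    ≡⟨ sumAll-suc n (λ x → h (x ⊕ (false ∷ a))) ⟩
  sumAll n (λ x → h (false ∷ (x ⊕ a))) ℤ.+ sumAll n (λ x → h (true ∷ (x ⊕ a)))
    ≡⟨ cong₂ ℤ._+_ (sumAll-translate n a (λ x → h (false ∷ x)))
                   (sumAll-translate n a (λ x → h (true ∷ x))) ⟩
  sumAll n (λ x → h (false ∷ x)) ℤ.+ sumAll n (λ x → h (true ∷ x))
    ≡⟨ sumAll-suc n h ⟨
  sumAll (suc n) h
    ∎
sumAll-translate (suc n) (true ∷ a) h = begin
  sumAll (suc n) (λ x → h (x ⊕ (true ∷ a)))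
    ≡⟨ sumAll-suc n (λ x → h (x ⊕ (true ∷ a))) ⟩
  sumAll n (λ x → h (true ∷ (x ⊕ a))) ℤ.+ sumAll n (λ x → h (false ∷ (x ⊕ a)))
    ≡⟨ cong₂ ℤ._+_ (sumAll-translate n a (λ x → h (true ∷ x)))
                   (sumAll-translate n a (λ x → h (false ∷ x))) ⟩
  sumAll n (λ x → h (true ∷ x)) ℤ.+ sumAll n (λ x → h (false ∷ x))
    ≡⟨ ℤ.+-comm (sumAll n (λ x → h (true ∷ x))) (sumAll n (λ x → h (false ∷ x))) ⟩
  sumAll n (λ x → h (false ∷ x)) ℤ.+ sumAll n (λ x → h (true ∷ x))
    ≡⟨ sumAll-suc n h ⟨
  sumAll (suc n) h
    ∎

fourierSum : ∀ {n} → (F2^ n → ℤ) → F2^ n → ℤ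
fourierSum {n} f γ = sumAll n (λ x → f x ℤ.* χ γ x)

signedShift : ∀ {n} → Bool → F2^ n → (F2^ n → ℤ) → F2^ n → ℤ
signedShift s a f x = sgn s ℤ.* f (x ⊕ a)

fourierSum-signedShift : ∀ {n} s (a : F2^ n) f γ →
  fourierSum (signedShift s a f) γ ≡ sgn (s xor dot n γ a) ℤ.* fourierSum f γ
fourierSum-signedShift {n} s a f γ = begin
  sumAll n (λ x → sgn s ℤ.* f (x ⊕ a) ℤ.* χ γ x)
    ≡⟨ sumAll-cong n (λ x → cong (λ y → sgn s ℤ.* f (x ⊕ a) ℤ.* χ γ y) (⊕-cancelʳ x a)) ⟨
  sumAll n (λ x → sgn s ℤ.* f (x ⊕ a) ℤ.* χ γ ((x ⊕ a) ⊕ a))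
    ≡⟨ sumAll-translate n a (λ y → sgn s ℤ.* f y ℤ.* χ γ (y ⊕ a)) ⟩
  sumAll n (λ y → sgn s ℤ.* f y ℤ.* χ γ (y ⊕ a))
    ≡⟨ sumAll-cong n (λ y → trans (cong (sgn s ℤ.* f y ℤ.*_) (χ-⊕ʳ γ y a))
                                  (*-rearrange (sgn s) (f y) (χ γ y) (χ γ a))) ⟩
  sumAll n (λ y → sgn s ℤ.* χ γ a ℤ.* (f y ℤ.* χ γ y))
    ≡⟨ sumAll-*ˡ n (sgn s ℤ.* χ γ a) (λ y → f y ℤ.* χ γ y) ⟩
  sgn s ℤ.* χ γ a ℤ.* fourierSum f γ
    ≡⟨ cong (λ c → sgn s ℤ.* c ℤ.* fourierSum f γ) (χ≡sgn∘dot γ a) ⟩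
  sgn s ℤ.* sgn (dot n γ a) ℤ.* fourierSum f γ
    ≡⟨ cong (ℤ._* fourierSum f γ) (sgn-xor s (dot n γ a)) ⟨
  sgn (s xor dot n γ a) ℤ.* fourierSum f γ
    ∎
  where
  *-rearrange : ∀ u v w z → u ℤ.* v ℤ.* (w ℤ.* z) ≡ u ℤ.* z ℤ.* (v ℤ.* w)
  *-rearrange = solve-∀

sgn-*-±1 : ∀ s {y} → (y ≡ + 1) ⊎ (y ≡ - (+ 1)) →
  (sgn s ℤ.* y ≡ + 1) ⊎ (sgn s ℤ.* y ≡ - (+ 1))
sgn-*-±1 false (inj₁ refl) = inj₁ refl
sgn-*-±1 false (inj₂ refl) = inj₂ refl
sgn-*-±1 true  (inj₁ refl) = inj₂ refl
sgn-*-±1 true  (inj₂ refl) = inj₁ refl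

IsBoolean-signedShift : ∀ {n} s (a : F2^ n) {f} → IsBoolean f → IsBoolean (signedShift s a f)
IsBoolean-signedShift s a isBool x = sgn-*-±1 s (isBool (x ⊕ a))

/≡0⇔≡0 : ∀ p d .{{_ : ℕ.NonZero d}} → (p ℚ./ d ≡ 0ℚ) ⇔ (p ≡ 0ℤ)
/≡0⇔≡0 p d = mk⇔ to (λ { refl → ℚ.0/n≡0 d })
  where
  to : p ℚ./ d ≡ 0ℚ → p ≡ 0ℤ
  to p/d≡0 = begin
    p                                    ≡⟨ ℚ.↥-/ p d ⟨
    ℚ.↥ (p ℚ./ d) ℤ.* ℤ.gcd p (+ d)      ≡⟨ cong (λ q → ℚ.↥ q ℤ.* ℤ.gcd p (+ d)) p/d≡0 ⟩
    0ℤ ℤ.* ℤ.gcd p (+ d)                 ≡⟨ ℤ.*-zeroˡ (ℤ.gcd p (+ d)) ⟩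
    0ℤ                                   ∎

pos⇒/-pos : ∀ p d .{{_ : ℕ.NonZero d}} → 0ℤ ℤ.< p → 0ℚ < p ℚ./ d
pos⇒/-pos (+ zero) d (+<+ ())
pos⇒/-pos +[1+ m ] d _ = ℚ.positive⁻¹ _ {{ℚ.normalize-pos (suc m) d}}

fourier≡0⇔fourierSum≡0 : ∀ {n} (f : F2^ n → ℤ) γ → (fourier f γ ≡ 0ℚ) ⇔ (fourierSum f γ ≡ 0ℤ)
fourier≡0⇔fourierSum≡0 {n} f γ = /≡0⇔≡0 (fourierSum f γ) (2 ℕ.^ n) {{m^n≢0 2 n}}

sgn-*≡0⇔≡0 : ∀ s c → (sgn s ℤ.* c ≡ 0ℤ) ⇔ (c ≡ 0ℤ)
sgn-*≡0⇔≡0 false c = mk⇔ (trans (sym (ℤ.*-identityˡ c))) (trans (ℤ.*-identityˡ c))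
sgn-*≡0⇔≡0 true  c = mk⇔
  (λ -c≡0 → trans (sym (ℤ.neg-involutive c)) (cong -_ (trans (sym (ℤ.-1*i≡-i c)) -c≡0)))
  (λ c≡0 → trans (ℤ.-1*i≡-i c) (cong -_ c≡0))

InSupport-signedShift : ∀ {n} s (a : F2^ n) f γ → InSupport (signedShift s a f) γ ⇔ InSupport f γ
InSupport-signedShift {n} s a f γ = mk⇔ (contraposition vanish) (contraposition unvanish)
  where
  open Equivalence
  vanish : fourier f γ ≡ 0ℚ → fourier (signedShift s a f) γ ≡ 0ℚ
  vanish f̂≡0 = from (fourier≡0⇔fourierSum≡0 (signedShift s a f) γ)
    (trans (fourierSum-signedShift s a f γ)
      (from (sgn-*≡0⇔≡0 (s xor dot n γ a) (fourierSum f γ)) (to (fourier≡0⇔fourierSum≡0 f γ) f̂≡0)))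
  unvanish : fourier (signedShift s a f) γ ≡ 0ℚ → fourier f γ ≡ 0ℚ
  unvanish ĝ≡0 = from (fourier≡0⇔fourierSum≡0 f γ)
    (to (sgn-*≡0⇔≡0 (s xor dot n γ a) (fourierSum f γ))
      (trans (sym (fourierSum-signedShift s a f γ)) (to (fourier≡0⇔fourierSum≡0 (signedShift s a f) γ) ĝ≡0)))

signBit : ℤ → Bool
signBit (+ _)    = false
signBit -[1+ _ ] = true

sgn-signBit-*-pos : ∀ c → c ≢ 0ℤ → 0ℤ ℤ.< sgn (signBit c) ℤ.* c
sgn-signBit-*-pos (+ zero)  c≢0 = contradiction refl c≢0
sgn-signBit-*-pos +[1+ _ ] _   = +<+ (s≤s z≤n)
sgn-signBit-*-pos -[1+ _ ] _   = +<+ (s≤s z≤n)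

fourier-signedShift-pos : ∀ {n} s (a : F2^ n) f γ → InSupport f γ →
  s xor dot n γ a ≡ signBit (fourierSum f γ) → 0ℚ < fourier (signedShift s a f) γ
fourier-signedShift-pos {n} s a f γ γ∈supp sign≡ =
  pos⇒/-pos (fourierSum (signedShift s a f) γ) (2 ℕ.^ n) {{m^n≢0 2 n}}
    (subst (0ℤ ℤ.<_) (sym (trans (fourierSum-signedShift s a f γ) (cong (λ b → sgn b ℤ.* fourierSum f γ) sign≡)))
      (sgn-signBit-*-pos (fourierSum f γ) (contraposition (Equivalence.from (fourier≡0⇔fourierSum≡0 f γ)) γ∈supp)))

proposition3 : (n : ℕ) (f : F2^ n → ℤ) → IsBoolean f →
    (α β : F2^ n) → InSupport f α → InSupport f β → α ≢ β →
    Σ (F2^ n → ℤ) λ g → IsBoolean g ×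
      (∀ γ → InSupport g γ ⇔ InSupport f γ) ×
      (0ℚ < fourier g α) × (0ℚ < fourier g β)
proposition3 n f isBool α β α∈supp β∈supp α≢β =
  signedShift s a f , IsBoolean-signedShift s a isBool , InSupport-signedShift s a f ,
  fourier-signedShift-pos s a f α α∈supp (xor-cancelʳ σα (dot n α a)) ,
  fourier-signedShift-pos s a f β β∈supp sβ≡σβ
  where
  σα σβ : Bool
  σα = signBit (fourierSum f α)
  σβ = signBit (fourierSum f β)
  a : F2^ n
  a = proj₁ (dot-xor-surjective n α≢β (σα xor σβ))
  a-realises : dot n α a xor dot n β a ≡ σα xor σβ
  a-realises = proj₂ (dot-xor-surjective n α≢β (σα xor σβ))
  s : Bool
  s = σα xor dot n α a
  sβ≡σβ : s xor dot n β a ≡ σβ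
  sβ≡σβ = begin
    (σα xor dot n α a) xor dot n β a ≡⟨ xor-assoc σα (dot n α a) (dot n β a) ⟩
    σα xor (dot n α a xor dot n β a) ≡⟨ cong (σα xor_) a-realises ⟩
    σα xor (σα xor σβ)               ≡⟨ xor-cancelˡ σα σβ ⟩
    σβ                               ∎
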